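{- Define $\mathbf c\mathbf d$-polynomials by $\alpha_0=-1$ and, for $k\ge1$, \[\alpha_{2k}=-\tfrac12\big[(\mathbf c^2-2\mathbf d)^k+\mathbf c(\mathbf c^2-2\mathbf d)^{k-1}\mathbf c\big],\qquad \alpha_{2k+1}=\tfrac12\big[(\mathbf c^2-2\mathbf d)^k\mathbf c+\mathbf c(\mathbf c^2-2\mathbf d)^k\big]\] (also for $k=0$ in the odd case, giving $\alpha_1=\mathbf c$), where $\mathbf c=\mathbf a+\mathbf b$, $\mathbf d=\mathbf a\mathbf b+\mathbf b\mathbf a$ in noncommuting variables $\mathbf a,\mathbf b$. Then for every $k\ge1$, \[\alpha_k=\mathbf a(\mathbf b-\mathbf a)^{k-1}+\Big((\mathbf a-\mathbf b)^{k-1}-\mathbf a(\mathbf a-\mathbf b)^{k-2}\big(1+(-1)^k\big)\Big)\mathbf b,\] where for $k=1$ the term with the factor $1+(-1)^k=0$ is read as zero. -}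

module Defs where

open import Level using (Level)
open import Data.Nat using (ℕ; zero; suc)
open import Data.Sum using (_⊎_; inj₁; inj₂; [_,_])
open import Algebra.Bundles using (Ring)

-- Parity decomposition: inj₁ k means n = 2k, inj₂ k means n = 2k+1.
half : ℕ → ℕ ⊎ ℕ
half zero    = inj₁ zero
half (suc n) = [ (λ k → inj₂ k) , (λ k → inj₁ (suc k)) ] (half n)

-- cd-polynomials evaluated at elements a, b of a ring R, with h a chosen
-- element playing the role of 1/2 (h + h ≈ 1 is assumed in the statement).
module CD {c ℓ : Level} (R : Ring c ℓ) (h a b : Ring.Carrier R) where
  open Ring R hiding (zero)

  infixr 8 _^_
  _^_ : Carrier → ℕ → Carrier
  x ^ zero  = 1#
  x ^ suc n = x * (x ^ n)

  𝐜 : Carrier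
  𝐜 = a + b

  𝐝 : Carrier
  𝐝 = a * b + b * a

  𝐞 : Carrier
  𝐞 = 𝐜 * 𝐜 - (𝐝 + 𝐝)

  αEven : ℕ → Carrier
  αEven zero    = - 1#
  αEven (suc k) = - (h * (𝐞 ^ suc k + 𝐜 * (𝐞 ^ k) * 𝐜))

  αOdd : ℕ → Carrier
  αOdd k = h * ((𝐞 ^ k) * 𝐜 + 𝐜 * (𝐞 ^ k))

  α : ℕ → Carrier
  α n = [ αEven , αOdd ] (half n)

  rhs : ℕ → Carrier
  rhs zero          = 0#   -- unused (n ≥ 1)
  rhs (suc zero)    = a * ((b - a) ^ zero) + ((a - b) ^ zero) * b
  rhs (suc (suc m)) =
    a * ((b - a) ^ suc m)
    + ((a - b) ^ suc m - a * ((a - b) ^ m) * (1# + (- 1#) ^ suc (suc m))) * b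

-- With u = a − b one has c² − 2d = u² = (b − a)², so the powers of c² − 2d
-- are the even powers of u, and they commute with u.  For n commuting with u:
-- n c + c n = 2 (a n + n b), since n a − n b = a n − b n; and by the
-- parallelogram law (a + b) n (a + b) + u n u = 2 (a n a + b n b).  Halving
-- gives α_{2k+1} = a n + n b and α_{2k+2} = −(a n a + b n b) with n = (c² − 2d)^k,
-- and expanding the right-hand side with u n = n u yields the same expressions.
module Submission where

open import Defs
open import Level using (Level)
open import Data.Nat using (ℕ; zero; suc)
open import Data.Sum using (inj₁; inj₂; [_,_])
open import Algebra.Bundles using (AbelianGroup; Ring)
open import Relation.Binary.PropositionalEquality as ≡ using (_≡_)

double : ℕ → ℕ
double zero    = zero
double (suc n) = suc (suc (double n))

data Parity : ℕ → Set where
  even : ∀ n → Parity (double n)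
  odd  : ∀ n → Parity (suc (double n))

parity : ∀ n → Parity n
parity zero = even zero
parity (suc n) with parity n
... | even m = odd m
... | odd m  = even (suc m)

half-double : ∀ n → half (double n) ≡ inj₁ n
half-double zero    = ≡.refl
half-double (suc n) rewrite half-double n = ≡.refl

half-suc-double : ∀ n → half (suc (double n)) ≡ inj₂ n
half-suc-double n rewrite half-double n = ≡.refl

module AbelianGroupProperties {c ℓ : Level} (G : AbelianGroup c ℓ) where
  open AbelianGroup G
  open import Algebra.Properties.AbelianGroup G
  open import Algebra.Properties.CommutativeSemigroup commutativeSemigroup
    using (interchange; xy∙z≈xz∙y)
  open import Relation.Binary.Reasoning.Setoid setoid

  xy∙zw≈xw∙zy : ∀ x y z w → (x ∙ y) ∙ (z ∙ w) ≈ (x ∙ w) ∙ (z ∙ y)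
  xy∙zw≈xw∙zy x y z w = begin
    (x ∙ y) ∙ (z ∙ w)  ≈⟨ ∙-congˡ (comm z w) ⟩
    (x ∙ y) ∙ (w ∙ z)  ≈⟨ interchange x y w z ⟩
    (x ∙ w) ∙ (y ∙ z)  ≈⟨ ∙-congˡ (comm y z) ⟩
    (x ∙ w) ∙ (z ∙ y)  ∎

  xy∙xy⁻¹≈x∙x : ∀ x y → (x ∙ y) ∙ (x ∙ y ⁻¹) ≈ x ∙ x
  xy∙xy⁻¹≈x∙x x y = begin
    (x ∙ y) ∙ (x ∙ y ⁻¹)  ≈⟨ interchange x y x (y ⁻¹) ⟩
    (x ∙ x) ∙ (y ∙ y ⁻¹)  ≈⟨ ∙-congˡ (inverseʳ y) ⟩
    (x ∙ x) ∙ ε           ≈⟨ identityʳ _ ⟩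
    x ∙ x                 ∎

  xy∙[yy]⁻¹≈xy⁻¹ : ∀ x y → (x ∙ y) ∙ (y ∙ y) ⁻¹ ≈ x ∙ y ⁻¹
  xy∙[yy]⁻¹≈xy⁻¹ x y = begin
    (x ∙ y) ∙ (y ∙ y) ⁻¹      ≈⟨ ∙-congˡ (⁻¹-∙-comm y y) ⟨
    (x ∙ y) ∙ (y ⁻¹ ∙ y ⁻¹)   ≈⟨ interchange x y (y ⁻¹) (y ⁻¹) ⟩
    (x ∙ y ⁻¹) ∙ (y ∙ y ⁻¹)   ≈⟨ ∙-congˡ (inverseʳ y) ⟩
    (x ∙ y ⁻¹) ∙ ε            ≈⟨ identityʳ _ ⟩
    x ∙ y ⁻¹                  ∎

  xy⁻¹∙[zx]⁻¹≈[yz]⁻¹ : ∀ x y z → (x ∙ y ⁻¹) ∙ (z ∙ x) ⁻¹ ≈ (y ∙ z) ⁻¹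
  xy⁻¹∙[zx]⁻¹≈[yz]⁻¹ x y z = begin
    (x ∙ y ⁻¹) ∙ (z ∙ x) ⁻¹      ≈⟨ ∙-congˡ (⁻¹-anti-homo-∙ z x) ⟩
    (x ∙ y ⁻¹) ∙ (x ⁻¹ ∙ z ⁻¹)   ≈⟨ interchange x (y ⁻¹) (x ⁻¹) (z ⁻¹) ⟩
    (x ∙ x ⁻¹) ∙ (y ⁻¹ ∙ z ⁻¹)   ≈⟨ ∙-congʳ (inverseʳ x) ⟩
    ε ∙ (y ⁻¹ ∙ z ⁻¹)            ≈⟨ identityˡ _ ⟩
    y ⁻¹ ∙ z ⁻¹                  ≈⟨ ⁻¹-∙-comm y z ⟩
    (y ∙ z) ⁻¹                   ∎

  xy⁻¹≈zw⁻¹⇒xw≈zy : ∀ {x y z w} → x ∙ y ⁻¹ ≈ z ∙ w ⁻¹ → x ∙ w ≈ z ∙ y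
  xy⁻¹≈zw⁻¹⇒xw≈zy {x} {y} {z} {w} eq = begin
    x ∙ w                   ≈⟨ ∙-congʳ (//-rightDividesˡ y x) ⟨
    (x ∙ y ⁻¹) ∙ y ∙ w      ≈⟨ ∙-congʳ (∙-congʳ eq) ⟩
    (z ∙ w ⁻¹) ∙ y ∙ w      ≈⟨ xy∙z≈xz∙y _ y w ⟩
    (z ∙ w ⁻¹) ∙ w ∙ y      ≈⟨ ∙-congʳ (//-rightDividesˡ w z) ⟩
    z ∙ y                   ∎

module RingProperties {c ℓ : Level} (R : Ring c ℓ) where
  open Ring R hiding (zero)
  open import Algebra.Properties.Ring R
  open AbelianGroupProperties +-abelianGroup
  open import Relation.Binary.Reasoning.Setoid setoid

  -x*-y≈x*y : ∀ x y → - x * - y ≈ x * y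
  -x*-y≈x*y x y = begin
    - x * - y      ≈⟨ -‿distribˡ-* x (- y) ⟨
    - (x * - y)    ≈⟨ -‿cong (-‿distribʳ-* x y) ⟨
    - - (x * y)    ≈⟨ -‿involutive _ ⟩
    x * y          ∎

  x+x≈x*[1+1] : ∀ x → x + x ≈ x * (1# + 1#)
  x+x≈x*[1+1] x = sym (trans (distribˡ x 1# 1#) (+-cong (*-identityʳ x) (*-identityʳ x)))

  h*[x+x]≈x : ∀ {h} → h + h ≈ 1# → ∀ x → h * (x + x) ≈ x
  h*[x+x]≈x {h} h+h≈1 x = begin
    h * (x + x)    ≈⟨ distribˡ h x x ⟩
    h * x + h * x  ≈⟨ distribʳ x h h ⟨
    (h + h) * x    ≈⟨ *-congʳ h+h≈1 ⟩
    1# * x         ≈⟨ *-identityˡ x ⟩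
    x              ∎

  sandwich-+ : ∀ n x y →
    (x + y) * n * (x + y) ≈ (x * n * x + y * n * y) + (x * n * y + y * n * x)
  sandwich-+ n x y = begin
    (x + y) * n * (x + y)                              ≈⟨ *-congʳ (distribʳ n x y) ⟩
    (x * n + y * n) * (x + y)                          ≈⟨ distribˡ _ x y ⟩
    (x * n + y * n) * x + (x * n + y * n) * y          ≈⟨ +-cong (distribʳ x _ _) (distribʳ y _ _) ⟩
    (x * n * x + y * n * x) + (x * n * y + y * n * y)  ≈⟨ xy∙zw≈xw∙zy _ _ _ _ ⟩
    (x * n * x + y * n * y) + (x * n * y + y * n * x)  ∎

  sandwich-- : ∀ n x y →
    (x - y) * n * (x - y) ≈ (x * n * x + y * n * y) - (x * n * y + y * n * x)
  sandwich-- n x y = begin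
    (x - y) * n * (x - y)                                    ≈⟨ sandwich-+ n x (- y) ⟩
    (x * n * x + - y * n * - y) + (x * n * - y + - y * n * x)
      ≈⟨ +-cong (+-congˡ -y*n*-y≈y*n*y) (+-cong (sym (-‿distribʳ-* _ y)) -y*n*x≈-[y*n*x]) ⟩
    (x * n * x + y * n * y) + (- (x * n * y) + - (y * n * x))  ≈⟨ +-congˡ (-‿+-comm _ _) ⟩
    (x * n * x + y * n * y) - (x * n * y + y * n * x)          ∎
    where
    -y*n≈-[y*n] : - y * n ≈ - (y * n)
    -y*n≈-[y*n] = sym (-‿distribˡ-* y n)
    -y*n*-y≈y*n*y : - y * n * - y ≈ y * n * y
    -y*n*-y≈y*n*y = trans (*-congʳ -y*n≈-[y*n]) (-x*-y≈x*y (y * n) y)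
    -y*n*x≈-[y*n*x] : - y * n * x ≈ - (y * n * x)
    -y*n*x≈-[y*n*x] = trans (*-congʳ -y*n≈-[y*n]) (sym (-‿distribˡ-* (y * n) x))

  parallelogram : ∀ n x y →
    (x + y) * n * (x + y) + (x - y) * n * (x - y) ≈
    (x * n * x + y * n * y) + (x * n * x + y * n * y)
  parallelogram n x y =
    trans (+-cong (sandwich-+ n x y) (sandwich-- n x y)) (xy∙xy⁻¹≈x∙x _ _)

  x*1#*y≈x*y : ∀ x y → x * 1# * y ≈ x * y
  x*1#*y≈x*y x y = *-congʳ (*-identityʳ x)

  square-+ : ∀ x y → (x + y) * (x + y) ≈ (x * x + y * y) + (x * y + y * x)
  square-+ x y = begin
    (x + y) * (x + y)                                      ≈⟨ x*1#*y≈x*y _ _ ⟨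
    (x + y) * 1# * (x + y)                                 ≈⟨ sandwich-+ 1# x y ⟩
    (x * 1# * x + y * 1# * y) + (x * 1# * y + y * 1# * x)  ≈⟨ +-cong (+-cong (x*1#*y≈x*y x x) (x*1#*y≈x*y y y))
                                                                      (+-cong (x*1#*y≈x*y x y) (x*1#*y≈x*y y x)) ⟩
    (x * x + y * y) + (x * y + y * x)                      ∎

  square-- : ∀ x y → (x - y) * (x - y) ≈ (x * x + y * y) - (x * y + y * x)
  square-- x y = begin
    (x - y) * (x - y)                                      ≈⟨ x*1#*y≈x*y _ _ ⟨
    (x - y) * 1# * (x - y)                                 ≈⟨ sandwich-- 1# x y ⟩
    (x * 1# * x + y * 1# * y) - (x * 1# * y + y * 1# * x)  ≈⟨ +-cong (+-cong (x*1#*y≈x*y x x) (x*1#*y≈x*y y y))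
                                                                      (-‿cong (+-cong (x*1#*y≈x*y x y) (x*1#*y≈x*y y x))) ⟩
    (x * x + y * y) - (x * y + y * x)                      ∎

module _ {c ℓ : Level} (R : Ring c ℓ) (h a b : Ring.Carrier R) where
  open Ring R hiding (zero)
  open CD R h a b
  open import Algebra.Properties.Ring R
  open AbelianGroupProperties +-abelianGroup
  open RingProperties R
  open import Relation.Binary.Reasoning.Setoid setoid

  ^-cong : ∀ {x y} n → x ≈ y → x ^ n ≈ y ^ n
  ^-cong zero    x≈y = refl
  ^-cong (suc n) x≈y = *-cong x≈y (^-cong n x≈y)

  ^-double : ∀ x n → x ^ double n ≈ (x * x) ^ n
  ^-double x zero    = refl
  ^-double x (suc n) = trans (sym (*-assoc x x _)) (*-congˡ (^-double x n))

  1#^n≈1# : ∀ n → 1# ^ n ≈ 1#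
  1#^n≈1# zero    = refl
  1#^n≈1# (suc n) = trans (*-identityˡ _) (1#^n≈1# n)

  -1#^double≈1# : ∀ n → (- 1#) ^ double n ≈ 1#
  -1#^double≈1# n = begin
    (- 1#) ^ double n    ≈⟨ ^-double (- 1#) n ⟩
    (- 1# * - 1#) ^ n    ≈⟨ ^-cong n (-x*-y≈x*y 1# 1#) ⟩
    (1# * 1#) ^ n        ≈⟨ ^-cong n (*-identityˡ 1#) ⟩
    1# ^ n               ≈⟨ 1#^n≈1# n ⟩
    1#                   ∎

  1#+-1#^suc-double≈0# : ∀ n → 1# + (- 1#) ^ suc (double n) ≈ 0#
  1#+-1#^suc-double≈0# n = begin
    1# + - 1# * (- 1#) ^ double n  ≈⟨ +-congˡ (*-congˡ (-1#^double≈1# n)) ⟩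
    1# + - 1# * 1#                 ≈⟨ +-congˡ (*-identityʳ _) ⟩
    1# - 1#                        ≈⟨ -‿inverseʳ 1# ⟩
    0#                             ∎

  ^-commute : ∀ {x y} n → x * y ≈ y * x → x ^ n * y ≈ y * x ^ n
  ^-commute {x} {y} zero    xy≈yx = trans (*-identityˡ y) (sym (*-identityʳ y))
  ^-commute {x} {y} (suc n) xy≈yx = begin
    x * x ^ n * y    ≈⟨ *-assoc x _ y ⟩
    x * (x ^ n * y)  ≈⟨ *-congˡ (^-commute n xy≈yx) ⟩
    x * (y * x ^ n)  ≈⟨ *-assoc x y _ ⟨
    x * y * x ^ n    ≈⟨ *-congʳ xy≈yx ⟩
    y * x * x ^ n    ≈⟨ *-assoc y x _ ⟩
    y * (x * x ^ n)  ∎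

  𝐮 : Carrier
  𝐮 = a - b

  𝐞≈𝐮*𝐮 : 𝐞 ≈ 𝐮 * 𝐮
  𝐞≈𝐮*𝐮 = begin
    𝐜 * 𝐜 - (𝐝 + 𝐝)                  ≈⟨ +-congʳ (square-+ a b) ⟩
    (a * a + b * b + 𝐝) - (𝐝 + 𝐝)    ≈⟨ xy∙[yy]⁻¹≈xy⁻¹ _ 𝐝 ⟩
    (a * a + b * b) - 𝐝              ≈⟨ square-- a b ⟨
    𝐮 * 𝐮                            ∎

  b-a≈-𝐮 : b - a ≈ - 𝐮
  b-a≈-𝐮 = sym (⁻¹-anti-homo‿- a b)

  𝐮^double≈𝐞^ : ∀ n → 𝐮 ^ double n ≈ 𝐞 ^ n
  𝐮^double≈𝐞^ n = trans (^-double 𝐮 n) (^-cong n (sym 𝐞≈𝐮*𝐮))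

  [b-a]^double≈𝐞^ : ∀ n → (b - a) ^ double n ≈ 𝐞 ^ n
  [b-a]^double≈𝐞^ n = begin
    (b - a) ^ double n      ≈⟨ ^-double (b - a) n ⟩
    ((b - a) * (b - a)) ^ n ≈⟨ ^-cong n (*-cong b-a≈-𝐮 b-a≈-𝐮) ⟩
    (- 𝐮 * - 𝐮) ^ n         ≈⟨ ^-cong n (-x*-y≈x*y 𝐮 𝐮) ⟩
    (𝐮 * 𝐮) ^ n             ≈⟨ ^-cong n 𝐞≈𝐮*𝐮 ⟨
    𝐞 ^ n                   ∎

  𝐞^n*𝐮≈𝐮*𝐞^n : ∀ n → 𝐞 ^ n * 𝐮 ≈ 𝐮 * 𝐞 ^ n
  𝐞^n*𝐮≈𝐮*𝐞^n n = ^-commute n (begin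
    𝐞 * 𝐮        ≈⟨ *-congʳ 𝐞≈𝐮*𝐮 ⟩
    𝐮 * 𝐮 * 𝐮    ≈⟨ *-assoc 𝐮 𝐮 𝐮 ⟩
    𝐮 * (𝐮 * 𝐮)  ≈⟨ *-congˡ 𝐞≈𝐮*𝐮 ⟨
    𝐮 * 𝐞        ∎)

  module _ {n : Carrier} (n𝐮≈𝐮n : n * 𝐮 ≈ 𝐮 * n) where

    n*[b-a]≈[b-a]*n : n * (b - a) ≈ (b - a) * n
    n*[b-a]≈[b-a]*n = begin
      n * (b - a)   ≈⟨ *-congˡ b-a≈-𝐮 ⟩
      n * - 𝐮       ≈⟨ -‿distribʳ-* n 𝐮 ⟨
      - (n * 𝐮)     ≈⟨ -‿cong n𝐮≈𝐮n ⟩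
      - (𝐮 * n)     ≈⟨ -‿distribˡ-* 𝐮 n ⟩
      - 𝐮 * n       ≈⟨ *-congʳ b-a≈-𝐮 ⟨
      (b - a) * n   ∎

    n*a+b*n≈a*n+n*b : n * a + b * n ≈ a * n + n * b
    n*a+b*n≈a*n+n*b = xy⁻¹≈zw⁻¹⇒xw≈zy (begin
      n * a - n * b  ≈⟨ x[y-z]≈xy-xz n a b ⟨
      n * 𝐮          ≈⟨ n𝐮≈𝐮n ⟩
      𝐮 * n          ≈⟨ [y-z]x≈yx-zx n a b ⟩
      a * n - b * n  ∎)

    n*𝐜+𝐜*n≈2[a*n+n*b] : n * 𝐜 + 𝐜 * n ≈ (a * n + n * b) + (a * n + n * b)
    n*𝐜+𝐜*n≈2[a*n+n*b] = begin
      n * 𝐜 + 𝐜 * n                    ≈⟨ +-cong (distribˡ n a b) (distribʳ n a b) ⟩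
      (n * a + n * b) + (a * n + b * n)  ≈⟨ xy∙zw≈xw∙zy _ _ _ _ ⟩
      (n * a + b * n) + (a * n + n * b)  ≈⟨ +-congʳ n*a+b*n≈a*n+n*b ⟩
      (a * n + n * b) + (a * n + n * b)  ∎

    𝐞*n+𝐜*n*𝐜≈2[a*n*a+b*n*b] :
      𝐞 * n + 𝐜 * n * 𝐜 ≈ (a * n * a + b * n * b) + (a * n * a + b * n * b)
    𝐞*n+𝐜*n*𝐜≈2[a*n*a+b*n*b] = begin
      𝐞 * n + 𝐜 * n * 𝐜          ≈⟨ +-congʳ 𝐞*n≈𝐮*n*𝐮 ⟩
      𝐮 * n * 𝐮 + 𝐜 * n * 𝐜      ≈⟨ +-comm _ _ ⟩
      𝐜 * n * 𝐜 + 𝐮 * n * 𝐮      ≈⟨ parallelogram n a b ⟩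
      (a * n * a + b * n * b) + (a * n * a + b * n * b) ∎
      where
      𝐞*n≈𝐮*n*𝐮 : 𝐞 * n ≈ 𝐮 * n * 𝐮
      𝐞*n≈𝐮*n*𝐮 = begin
        𝐞 * n        ≈⟨ *-congʳ 𝐞≈𝐮*𝐮 ⟩
        𝐮 * 𝐮 * n    ≈⟨ *-assoc 𝐮 𝐮 n ⟩
        𝐮 * (𝐮 * n)  ≈⟨ *-congˡ n𝐮≈𝐮n ⟨
        𝐮 * (n * 𝐮)  ≈⟨ *-assoc 𝐮 n 𝐮 ⟨
        𝐮 * n * 𝐮    ∎

    a*[[b-a]*n]+[𝐮*n-a*n*2]*b≈-[a*n*a+b*n*b] :
      a * ((b - a) * n) + (𝐮 * n - a * n * (1# + 1#)) * b ≈ - (a * n * a + b * n * b)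
    a*[[b-a]*n]+[𝐮*n-a*n*2]*b≈-[a*n*a+b*n*b] = begin
      a * ((b - a) * n) + (𝐮 * n - a * n * (1# + 1#)) * b
        ≈⟨ +-cong first second ⟩
      (a * n * b - a * n * a) - (b * n * b + a * n * b)
        ≈⟨ xy⁻¹∙[zx]⁻¹≈[yz]⁻¹ _ _ _ ⟩
      - (a * n * a + b * n * b)  ∎
      where
      first : a * ((b - a) * n) ≈ a * n * b - a * n * a
      first = begin
        a * ((b - a) * n)  ≈⟨ *-congˡ n*[b-a]≈[b-a]*n ⟨
        a * (n * (b - a))  ≈⟨ *-assoc a n _ ⟨
        a * n * (b - a)    ≈⟨ x[y-z]≈xy-xz (a * n) b a ⟩
        a * n * b - a * n * a ∎
      second : (𝐮 * n - a * n * (1# + 1#)) * b ≈ - (b * n * b + a * n * b)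
      second = begin
        (𝐮 * n - a * n * (1# + 1#)) * b
          ≈⟨ *-congʳ (+-cong ([y-z]x≈yx-zx n a b) (-‿cong (sym (x+x≈x*[1+1] (a * n))))) ⟩
        ((a * n - b * n) - (a * n + a * n)) * b  ≈⟨ *-congʳ (xy⁻¹∙[zx]⁻¹≈[yz]⁻¹ _ _ _) ⟩
        - (b * n + a * n) * b                    ≈⟨ -‿distribˡ-* _ b ⟨
        - ((b * n + a * n) * b)                  ≈⟨ -‿cong (distribʳ b _ _) ⟩
        - (b * n * b + a * n * b)                ∎

  module _ (h+h≈1 : h + h ≈ 1#) where

    α-suc-double : ∀ n → α (suc (double n)) ≈ a * 𝐞 ^ n + 𝐞 ^ n * b
    α-suc-double n = begin
      α (suc (double n))            ≡⟨ ≡.cong [ αEven , αOdd ] (half-suc-double n) ⟩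
      h * (𝐞 ^ n * 𝐜 + 𝐜 * 𝐞 ^ n)  ≈⟨ *-congˡ (n*𝐜+𝐜*n≈2[a*n+n*b] (𝐞^n*𝐮≈𝐮*𝐞^n n)) ⟩
      h * ((a * 𝐞 ^ n + 𝐞 ^ n * b) + (a * 𝐞 ^ n + 𝐞 ^ n * b))  ≈⟨ h*[x+x]≈x h+h≈1 _ ⟩
      a * 𝐞 ^ n + 𝐞 ^ n * b         ∎

    α-double-suc : ∀ n → α (double (suc n)) ≈ - (a * 𝐞 ^ n * a + b * 𝐞 ^ n * b)
    α-double-suc n = begin
      α (double (suc n))                          ≡⟨ ≡.cong [ αEven , αOdd ] (half-double (suc n)) ⟩
      - (h * (𝐞 * 𝐞 ^ n + 𝐜 * 𝐞 ^ n * 𝐜))         ≈⟨ -‿cong (*-congˡ (𝐞*n+𝐜*n*𝐜≈2[a*n*a+b*n*b] (𝐞^n*𝐮≈𝐮*𝐞^n n))) ⟩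
      - (h * ((a * 𝐞 ^ n * a + b * 𝐞 ^ n * b) + (a * 𝐞 ^ n * a + b * 𝐞 ^ n * b)))
                                                  ≈⟨ -‿cong (h*[x+x]≈x h+h≈1 _) ⟩
      - (a * 𝐞 ^ n * a + b * 𝐞 ^ n * b)           ∎

  rhs-suc-double : ∀ n → rhs (suc (double n)) ≈ a * 𝐞 ^ n + 𝐞 ^ n * b
  rhs-suc-double zero    = refl
  rhs-suc-double (suc n) =
    +-cong (*-congˡ ([b-a]^double≈𝐞^ (suc n))) (*-congʳ coefficient-of-b≈𝐞^)
    where
    coefficient-of-b≈𝐞^ :
      𝐮 ^ double (suc n) - a * 𝐮 ^ suc (double n) * (1# + (- 1#) ^ suc (double (suc n))) ≈ 𝐞 ^ suc n
    coefficient-of-b≈𝐞^ = begin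
      𝐮 ^ double (suc n) - a * 𝐮 ^ suc (double n) * (1# + (- 1#) ^ suc (double (suc n)))
        ≈⟨ +-cong (𝐮^double≈𝐞^ (suc n)) (-‿cong (*-congˡ (1#+-1#^suc-double≈0# (suc n)))) ⟩
      𝐞 ^ suc n - a * 𝐮 ^ suc (double n) * 0#  ≈⟨ +-congˡ (-‿cong (zeroʳ _)) ⟩
      𝐞 ^ suc n - 0#                            ≈⟨ +-congˡ -0#≈0# ⟩
      𝐞 ^ suc n + 0#                            ≈⟨ +-identityʳ _ ⟩
      𝐞 ^ suc n                                 ∎

  rhs-double-suc : ∀ n → rhs (double (suc n)) ≈ - (a * 𝐞 ^ n * a + b * 𝐞 ^ n * b)
  rhs-double-suc n = begin
    a * (b - a) ^ suc (double n)
      + (𝐮 ^ suc (double n) - a * 𝐮 ^ double n * (1# + (- 1#) ^ double (suc n))) * b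
      ≈⟨ +-cong (*-congˡ (*-congˡ ([b-a]^double≈𝐞^ n)))
                (*-congʳ (+-cong (*-congˡ (𝐮^double≈𝐞^ n))
                                 (-‿cong (*-cong (*-congˡ (𝐮^double≈𝐞^ n)) (+-congˡ (-1#^double≈1# (suc n))))))) ⟩
    a * ((b - a) * 𝐞 ^ n) + (𝐮 * 𝐞 ^ n - a * 𝐞 ^ n * (1# + 1#)) * b
      ≈⟨ a*[[b-a]*n]+[𝐮*n-a*n*2]*b≈-[a*n*a+b*n*b] (𝐞^n*𝐮≈𝐮*𝐞^n n) ⟩
    - (a * 𝐞 ^ n * a + b * 𝐞 ^ n * b)  ∎

lemma3p4 : ∀ {c ℓ : Level} (R : Ring c ℓ) (h a b : Ring.Carrier R) →
           Ring._≈_ R (Ring._+_ R h h) (Ring.1# R) →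
           ∀ (k : ℕ) → Ring._≈_ R (CD.α R h a b (suc k)) (CD.rhs R h a b (suc k))
lemma3p4 R h a b h+h≈1 k with parity k
... | even n = trans (α-suc-double R h a b h+h≈1 n) (sym (rhs-suc-double R h a b n))
  where open Ring R using (trans; sym)
... | odd n  = trans (α-double-suc R h a b h+h≈1 n) (sym (rhs-double-suc R h a b n))
  where open Ring R using (trans; sym)
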